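{- Let $N\geq1$, $q$ a prime power, and let $\mathcal{L}$ be a higgledy-piggledy line set of $\mathrm{PG}(N,q)$ with $|\mathcal{L}|=N+\lfloor N/2\rfloor\leq q$. Then every $\lceil (N+1)/2\rceil$ lines of $\mathcal{L}$ span the whole space $\mathrm{PG}(N,q)$.
   Context: $\mathrm{PG}(N,q)$ denotes the Desarguesian projective space of dimension $N$ over $\mathbb{F}_q$. A set $\mathcal{L}$ of lines is higgledy-piggledy if the set of points lying on at least one line of $\mathcal{L}$ meets every hyperplane $\kappa$ in a set of points spanning $\kappa$. -}

module Defs where

open import Level using (0ℓ)
open import Data.Nat using (ℕ; zero; suc; _^_)
open import Data.Nat.Primality using (Prime)
open import Data.Fin using (Fin) renaming (zero to fzero; suc to fsuc)
open import Data.Product using (Σ; ∃; _×_; _,_)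
open import Data.Sum using (_⊎_)
open import Relation.Nullary using (¬_)
open import Relation.Binary.PropositionalEquality using (_≡_)
open import Algebra.Structures using (IsCommutativeRing)

IsPrimePower : ℕ → Set
IsPrimePower q = Σ ℕ λ p → Σ ℕ λ k → Prime p × (q ≡ p ^ suc k)

-- A finite field with exactly q elements, carrier Fin q
-- (every field of order q is isomorphic to one of this form).
record FiniteField (q : ℕ) : Set where
  field
    _+_ _*_ : Fin q → Fin q → Fin q
    -_      : Fin q → Fin q
    0# 1#   : Fin q
    isCommutativeRing : IsCommutativeRing _≡_ _+_ _*_ -_ 0# 1#
    0≢1     : ¬ (0# ≡ 1#)
    inverse : ∀ x → ¬ (x ≡ 0#) → Σ (Fin q) λ y → (x * y) ≡ 1#

module Geometry {q : ℕ} (F : FiniteField q) (N : ℕ) where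
  open FiniteField F

  Vec : Set
  Vec = Fin (suc N) → Fin q

  _≋_ : Vec → Vec → Set
  u ≋ v = ∀ i → u i ≡ v i

  zeroV : Vec
  zeroV _ = 0#

  _⊕_ : Vec → Vec → Vec
  (u ⊕ v) i = u i + v i

  _·_ : Fin q → Vec → Vec
  (a · v) i = a * v i

  lincomb : (n : ℕ) → (Fin n → Fin q) → (Fin n → Vec) → Vec
  lincomb zero c x = zeroV
  lincomb (suc n) c x = (c fzero · x fzero) ⊕ lincomb n (λ i → c (fsuc i)) (λ i → x (fsuc i))

  InSpan : (Vec → Set) → Vec → Set
  InSpan P v = Σ ℕ λ n → Σ (Fin n → Fin q) λ c → Σ (Fin n → Vec) λ x →
               (∀ i → P (x i)) × (v ≋ lincomb n c x)

  -- vector representing a projective point of PG(N,q)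
  NonZero : Vec → Set
  NonZero v = ¬ (v ≋ zeroV)

  record Line : Set where
    constructor line
    field
      u w   : Vec
      indep : ∀ a b → ((a · u) ⊕ (b · w)) ≋ zeroV → (a ≡ 0#) × (b ≡ 0#)

  OnLine : Vec → Line → Set
  OnLine x l = NonZero x × Σ (Fin q) λ a → Σ (Fin q) λ b → x ≋ ((a · Line.u l) ⊕ (b · Line.w l))

  SameLine : Line → Line → Set
  SameLine l m = (∀ x → OnLine x l → OnLine x m) × (∀ x → OnLine x m → OnLine x l)

  dot : (n : ℕ) → (Fin n → Fin q) → (Fin n → Fin q) → Fin q
  dot zero a x = 0#
  dot (suc n) a x = (a fzero * x fzero) + dot n (λ i → a (fsuc i)) (λ i → x (fsuc i))

  InHyperplane : Vec → Vec → Set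
  InHyperplane a x = dot (suc N) a x ≡ 0#

  OnSomeLine : {k : ℕ} → (Fin k → Line) → Vec → Set
  OnSomeLine {k} L x = Σ (Fin k) λ i → OnLine x (L i)

  -- the lines are pairwise distinct (so the set has exactly k elements)
  Distinct : {k : ℕ} → (Fin k → Line) → Set
  Distinct {k} L = ∀ i j → SameLine (L i) (L j) → i ≡ j

  HiggledyPiggledy : {k : ℕ} → (Fin k → Line) → Set
  HiggledyPiggledy L = ∀ a → NonZero a → ∀ v → InHyperplane a v →
    InSpan (λ x → OnSomeLine L x × InHyperplane a x) v

  SpansSpace : {m : ℕ} → (Fin m → Line) → Set
  SpansSpace L = ∀ v → InSpan (OnSomeLine L) v

module Submission where

-- If the chosen ⌈(N+1)/2⌉ lines did not span PG(N,q), Gaussian elimination on their spanning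
-- vectors would give a hyperplane a containing all of them. Each of the remaining N - 1 lines
-- meets a in a point; these points and one point off a lie on a second hyperplane b. A line not in
-- a lies entirely in at most one hyperplane b + t a of the pencil, so, as N - 1 < q, some member c
-- of the pencil contains none of them. Each remaining line then meets c only in its point on a,
-- and the chosen lines lie in a, so the points of ∪ L on c lie in c ∩ a ≠ c and cannot span c.

open import Level using (0ℓ)
open import Defs
open import Data.Nat as ℕ using (ℕ; zero; suc; z≤n; s≤s)
import Data.Nat.Properties as ℕP
open import Data.Nat.DivMod using (m/n≡1+[m∸n]/n)
import Data.Integer as ℤ
import Data.Integer.Properties as ℤP
open import Data.Sign as Sign using (Sign)
open import Data.Fin as Fin using (Fin; punchIn; punchOut) renaming (zero to fzero; suc to fsuc)
import Data.Fin.Properties as FinP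
open import Data.Vec.Functional using (head; tail; _∷_; _++_)
open import Data.Vec.Functional.Properties using (lookup-++ˡ; lookup-++ʳ)
open import Function using (_∘_)
open import Function.Definitions using (Injective)
open import Data.Maybe using (Maybe; just; nothing)
open import Data.Product using (Σ; _×_; _,_; proj₁; proj₂)
open import Data.Sum using (_⊎_; inj₁; inj₂; [_,_])
open import Data.Empty using (⊥; ⊥-elim)
open import Relation.Nullary using (¬_; Dec; yes; no)
open import Relation.Nullary.Decidable using (_×-dec_; ¬?)
open import Relation.Binary.PropositionalEquality as ≡ using (_≡_; _≢_; refl; sym; trans; cong; cong₂; subst)
open import Algebra.Bundles using (CommutativeRing)
open import Algebra.Solver.Ring.AlmostCommutativeRing
  using (AlmostCommutativeRing; fromCommutativeRing; _-Raw-AlmostCommutative⟶_)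

-- The ring solver needs a coefficient ring whose equality computes; ℤ, mapped into R
-- by n ↦ n × 1#, serves for every commutative ring.
module IntegerCoefficients (R : CommutativeRing 0ℓ 0ℓ) where
  open import Data.Integer using (ℤ; +_; -[1+_]; +0; +[1+_])
  open CommutativeRing R renaming (refl to ≈-refl; sym to ≈-sym; trans to ≈-trans)
  open import Algebra.Properties.Ring ring using (-1*x≈-x)
  open import Algebra.Properties.AbelianGroup +-abelianGroup using (⁻¹-∙-comm; ⁻¹-involutive; ε⁻¹≈ε)
  open import Algebra.Properties.Semiring.Mult semiring using (×-homo-+; ×1-homo-*) renaming (_×_ to _×ᴿ_)
  open import Relation.Binary.Reasoning.Setoid setoid

  ⟦_⟧ : ℤ → Carrier
  ⟦ + n ⟧ = n ×ᴿ 1#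
  ⟦ -[1+ n ] ⟧ = - (suc n ×ᴿ 1#)

  ⟦-+⟧ : ∀ n → ⟦ ℤ.- (+ n) ⟧ ≈ - (n ×ᴿ 1#)
  ⟦-+⟧ zero = ≈-sym ε⁻¹≈ε
  ⟦-+⟧ (suc n) = ≈-refl

  x+y-y≈x : ∀ x y → (x + y) + - y ≈ x
  x+y-y≈x x y = begin
    (x + y) + - y  ≈⟨ +-assoc _ _ _ ⟩
    x + (y + - y)  ≈⟨ +-congˡ (-‿inverseʳ y) ⟩
    x + 0#         ≈⟨ +-identityʳ x ⟩
    x              ∎

  -x≈y-[x+y] : ∀ x y → - x ≈ y + - (x + y)
  -x≈y-[x+y] x y = begin
    - x                 ≈⟨ x+y-y≈x (- x) y ⟨
    (- x + y) + - y     ≈⟨ +-congʳ (+-comm _ _) ⟩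
    (y + - x) + - y     ≈⟨ +-assoc _ _ _ ⟩
    y + (- x + - y)     ≈⟨ +-congˡ (⁻¹-∙-comm x y) ⟩
    y + - (x + y)       ∎

  ⟦⊖⟧ : ∀ m n → ⟦ m ℤ.⊖ n ⟧ ≈ m ×ᴿ 1# + - (n ×ᴿ 1#)
  ⟦⊖⟧ m n with ℕP.<-≤-connex m n
  ... | inj₁ m<n = begin
    ⟦ m ℤ.⊖ n ⟧                                ≡⟨ cong ⟦_⟧ (ℤP.⊖-< m<n) ⟩
    ⟦ ℤ.- (+ (n ℕ.∸ m)) ⟧                      ≈⟨ ⟦-+⟧ (n ℕ.∸ m) ⟩
    - ((n ℕ.∸ m) ×ᴿ 1#)                         ≈⟨ -x≈y-[x+y] _ _ ⟩
    m ×ᴿ 1# + - ((n ℕ.∸ m) ×ᴿ 1# + m ×ᴿ 1#)       ≈⟨ +-congˡ (-‿cong (×-homo-+ 1# (n ℕ.∸ m) m)) ⟨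
    m ×ᴿ 1# + - ((n ℕ.∸ m ℕ.+ m) ×ᴿ 1#)          ≡⟨ cong (λ k → m ×ᴿ 1# + - (k ×ᴿ 1#)) (ℕP.m∸n+n≡m (ℕP.<⇒≤ m<n)) ⟩
    m ×ᴿ 1# + - (n ×ᴿ 1#)                        ∎
  ... | inj₂ n≤m = begin
    ⟦ m ℤ.⊖ n ⟧                                ≡⟨ cong ⟦_⟧ (ℤP.⊖-≥ n≤m) ⟩
    (m ℕ.∸ n) ×ᴿ 1#                             ≈⟨ x+y-y≈x _ _ ⟨
    ((m ℕ.∸ n) ×ᴿ 1# + n ×ᴿ 1#) + - (n ×ᴿ 1#)     ≈⟨ +-congʳ (×-homo-+ 1# (m ℕ.∸ n) n) ⟨
    ((m ℕ.∸ n ℕ.+ n) ×ᴿ 1#) + - (n ×ᴿ 1#)        ≡⟨ cong (λ k → k ×ᴿ 1# + - (n ×ᴿ 1#)) (ℕP.m∸n+n≡m n≤m) ⟩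
    m ×ᴿ 1# + - (n ×ᴿ 1#)                        ∎

  ⟦+⟧ : ∀ i j → ⟦ i ℤ.+ j ⟧ ≈ ⟦ i ⟧ + ⟦ j ⟧
  ⟦+⟧ -[1+ m ] -[1+ n ] = begin
    - (suc (suc (m ℕ.+ n)) ×ᴿ 1#)       ≡⟨ cong (λ k → - (suc k ×ᴿ 1#)) (≡.sym (ℕP.+-suc m n)) ⟩
    - ((suc m ℕ.+ suc n) ×ᴿ 1#)         ≈⟨ -‿cong (×-homo-+ 1# (suc m) (suc n)) ⟩
    - (suc m ×ᴿ 1# + suc n ×ᴿ 1#)        ≈⟨ ⁻¹-∙-comm _ _ ⟨
    - (suc m ×ᴿ 1#) + - (suc n ×ᴿ 1#)    ∎
  ⟦+⟧ -[1+ m ] (+ n) = ≈-trans (⟦⊖⟧ n (suc m)) (+-comm _ _)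
  ⟦+⟧ (+ m) -[1+ n ] = ⟦⊖⟧ m (suc n)
  ⟦+⟧ (+ m) (+ n) = ×-homo-+ 1# m n

  ⟦-⟧ : ∀ i → ⟦ ℤ.- i ⟧ ≈ - ⟦ i ⟧
  ⟦-⟧ -[1+ n ] = ≈-sym (⁻¹-involutive _)
  ⟦-⟧ +0 = ≈-sym ε⁻¹≈ε
  ⟦-⟧ +[1+ n ] = ≈-refl

  ⟦_⟧ˢ : Sign → Carrier
  ⟦ Sign.+ ⟧ˢ = 1#
  ⟦ Sign.- ⟧ˢ = - 1#

  ⟦◃⟧ : ∀ s n → ⟦ s ℤ.◃ n ⟧ ≈ ⟦ s ⟧ˢ * (n ×ᴿ 1#)
  ⟦◃⟧ s zero = ≈-sym (zeroʳ _)
  ⟦◃⟧ Sign.+ (suc n) = ≈-sym (*-identityˡ _)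
  ⟦◃⟧ Sign.- (suc n) = ≈-sym (-1*x≈-x _)

  ⟦⟧≈sign*abs : ∀ i → ⟦ i ⟧ ≈ ⟦ ℤ.sign i ⟧ˢ * (ℤ.∣ i ∣ ×ᴿ 1#)
  ⟦⟧≈sign*abs i = ≈-trans (reflexive (cong ⟦_⟧ (≡.sym (ℤP.◃-inverse i)))) (⟦◃⟧ (ℤ.sign i) ℤ.∣ i ∣)

  ⟦*⟧ˢ : ∀ s t → ⟦ s Sign.* t ⟧ˢ ≈ ⟦ s ⟧ˢ * ⟦ t ⟧ˢ
  ⟦*⟧ˢ Sign.- Sign.- = ≈-sym (≈-trans (-1*x≈-x _) (⁻¹-involutive _))
  ⟦*⟧ˢ Sign.- Sign.+ = ≈-sym (*-identityʳ _)
  ⟦*⟧ˢ Sign.+ Sign.- = ≈-sym (*-identityˡ _)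
  ⟦*⟧ˢ Sign.+ Sign.+ = ≈-sym (*-identityˡ _)

  [xy][zw]≈[xz][yw] : ∀ x y z w → (x * y) * (z * w) ≈ (x * z) * (y * w)
  [xy][zw]≈[xz][yw] x y z w = begin
    (x * y) * (z * w)  ≈⟨ *-assoc _ _ _ ⟩
    x * (y * (z * w))  ≈⟨ *-congˡ (*-assoc _ _ _) ⟨
    x * ((y * z) * w)  ≈⟨ *-congˡ (*-congʳ (*-comm _ _)) ⟩
    x * ((z * y) * w)  ≈⟨ *-congˡ (*-assoc _ _ _) ⟩
    x * (z * (y * w))  ≈⟨ *-assoc _ _ _ ⟨
    (x * z) * (y * w)  ∎

  ⟦*⟧ : ∀ i j → ⟦ i ℤ.* j ⟧ ≈ ⟦ i ⟧ * ⟦ j ⟧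
  ⟦*⟧ i j = begin
    ⟦ i ℤ.* j ⟧
      ≈⟨ ⟦◃⟧ (ℤ.sign i Sign.* ℤ.sign j) (ℤ.∣ i ∣ ℕ.* ℤ.∣ j ∣) ⟩
    ⟦ ℤ.sign i Sign.* ℤ.sign j ⟧ˢ * ((ℤ.∣ i ∣ ℕ.* ℤ.∣ j ∣) ×ᴿ 1#)
      ≈⟨ *-cong (⟦*⟧ˢ (ℤ.sign i) (ℤ.sign j)) (×1-homo-* ℤ.∣ i ∣ ℤ.∣ j ∣) ⟩
    (⟦ ℤ.sign i ⟧ˢ * ⟦ ℤ.sign j ⟧ˢ) * ((ℤ.∣ i ∣ ×ᴿ 1#) * (ℤ.∣ j ∣ ×ᴿ 1#))
      ≈⟨ [xy][zw]≈[xz][yw] _ _ _ _ ⟩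
    (⟦ ℤ.sign i ⟧ˢ * (ℤ.∣ i ∣ ×ᴿ 1#)) * (⟦ ℤ.sign j ⟧ˢ * (ℤ.∣ j ∣ ×ᴿ 1#))
      ≈⟨ *-cong (⟦⟧≈sign*abs i) (⟦⟧≈sign*abs j) ⟨
    ⟦ i ⟧ * ⟦ j ⟧
      ∎

  fromℤ : ℤ.+-*-rawRing -Raw-AlmostCommutative⟶ fromCommutativeRing R
  fromℤ = record
    { ⟦_⟧ = ⟦_⟧ ; +-homo = ⟦+⟧ ; *-homo = ⟦*⟧ ; -‿homo = ⟦-⟧
    ; 0-homo = ≈-refl ; 1-homo = +-identityʳ _ }

  ⟦⟧-equal? : ∀ i j → Maybe (⟦ i ⟧ ≈ ⟦ j ⟧)
  ⟦⟧-equal? i j with i ℤ.≟ j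
  ... | yes refl = just ≈-refl
  ... | no _ = nothing

  open import Algebra.Solver.Ring ℤ.+-*-rawRing (fromCommutativeRing R) fromℤ ⟦⟧-equal?
    using (solve; _:+_; _:*_; :-_; _:=_) public

module FieldArithmetic {q : ℕ} (F : FiniteField q) where
  commutativeRing : CommutativeRing 0ℓ 0ℓ
  commutativeRing = record { isCommutativeRing = FiniteField.isCommutativeRing F }

  open CommutativeRing commutativeRing public
    using (_+_; _*_; -_; 0#; 1#; +-identityˡ; +-identityʳ; *-identityˡ; *-identityʳ;
           zeroˡ; zeroʳ; -‿inverseʳ; +-assoc; +-comm; *-comm)
  open IntegerCoefficients commutativeRing public using (solve; _:+_; _:*_; :-_; _:=_)
  open FiniteField F public using (inverse)
  open FiniteField F using (0≢1)
  open ≡.≡-Reasoning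

  infix 4 _≟_
  _≟_ : (x y : Fin q) → Dec (x ≡ y)
  _≟_ = Fin._≟_

  1≢0 : 1# ≢ 0#
  1≢0 1≡0 = 0≢1 (sym 1≡0)

  -0≡0 : - 0# ≡ 0#
  -0≡0 = trans (sym (+-identityˡ (- 0#))) (-‿inverseʳ 0#)

  -x≢0 : ∀ {x} → x ≢ 0# → - x ≢ 0#
  -x≢0 {x} x≢0 -x≡0 = x≢0 (begin
    x        ≡⟨ solve 1 (λ x → x := :- (:- x)) refl x ⟩
    - (- x)  ≡⟨ cong -_ -x≡0 ⟩
    - 0#     ≡⟨ -0≡0 ⟩
    0#       ∎)

  x*y≡0⇒y≡0 : ∀ {x y} → x ≢ 0# → x * y ≡ 0# → y ≡ 0#
  x*y≡0⇒y≡0 {x} {y} x≢0 xy≡0 with inverse x x≢0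
  ... | x⁻¹ , xx⁻¹≡1 = begin
    y               ≡⟨ sym (*-identityˡ y) ⟩
    1# * y          ≡⟨ cong (_* y) (sym xx⁻¹≡1) ⟩
    (x * x⁻¹) * y   ≡⟨ solve 3 (λ x x⁻¹ y → (x :* x⁻¹) :* y := x⁻¹ :* (x :* y)) refl x x⁻¹ y ⟩
    x⁻¹ * (x * y)   ≡⟨ cong (x⁻¹ *_) xy≡0 ⟩
    x⁻¹ * 0#        ≡⟨ zeroʳ x⁻¹ ⟩
    0#              ∎

  x*y≡0⇒x≡0 : ∀ {x y} → y ≢ 0# → x * y ≡ 0# → x ≡ 0#
  x*y≡0⇒x≡0 {x} {y} y≢0 xy≡0 = x*y≡0⇒y≡0 y≢0 (trans (*-comm y x) xy≡0)

  x*0-y*0≡0 : ∀ x y → x * 0# + - (y * 0#) ≡ 0#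
  x*0-y*0≡0 x y = trans (cong₂ (λ a b → a + - b) (zeroʳ x) (zeroʳ y)) (-‿inverseʳ 0#)

  x*0+y*0≡0 : ∀ x y → x * 0# + y * 0# ≡ 0#
  x*0+y*0≡0 x y = trans (cong₂ _+_ (zeroʳ x) (zeroʳ y)) (+-identityʳ 0#)

  NotBothZero : Fin q → Fin q → Set
  NotBothZero x y = ¬ (x ≡ 0# × y ≡ 0#)

  nonzeroComponent : ∀ {x y} → NotBothZero x y → x ≢ 0# ⊎ y ≢ 0#
  nonzeroComponent {x} {y} x,y≢0 with x ≟ 0# | y ≟ 0#
  ... | no x≢0 | _      = inj₁ x≢0
  ... | yes _  | no y≢0 = inj₂ y≢0
  ... | yes x≡0 | yes y≡0 = ⊥-elim (x,y≢0 (x≡0 , y≡0))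

  det : Fin q → Fin q → Fin q → Fin q → Fin q
  det α β γ δ = α * δ + - (β * γ)

  -- The kernel of a nonzero functional on F² is one-dimensional.
  det≡0-of-kernel : ∀ {α β γ δ u w} → α * u + β * w ≡ 0# → γ * u + δ * w ≡ 0# →
    NotBothZero u w → det α β γ δ ≡ 0#
  det≡0-of-kernel {α} {β} {γ} {δ} {u} {w} αβ γδ u,w≢0 with nonzeroComponent u,w≢0
  ... | inj₁ u≢0 = x*y≡0⇒x≡0 u≢0 (begin
    det α β γ δ * u                              ≡⟨ solve 6 (λ α β γ δ u w →
                                                      (α :* δ :+ :- (β :* γ)) :* u
                                                      := δ :* (α :* u :+ β :* w) :+ :- (β :* (γ :* u :+ δ :* w)))
                                                    refl α β γ δ u w ⟩
    δ * (α * u + β * w) + - (β * (γ * u + δ * w)) ≡⟨ cong₂ (λ x y → δ * x + - (β * y)) αβ γδ ⟩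
    δ * 0# + - (β * 0#)                          ≡⟨ x*0-y*0≡0 δ β ⟩
    0#                                           ∎)
  ... | inj₂ w≢0 = x*y≡0⇒x≡0 w≢0 (begin
    det α β γ δ * w                              ≡⟨ solve 6 (λ α β γ δ u w →
                                                      (α :* δ :+ :- (β :* γ)) :* w
                                                      := α :* (γ :* u :+ δ :* w) :+ :- (γ :* (α :* u :+ β :* w)))
                                                    refl α β γ δ u w ⟩
    α * (γ * u + δ * w) + - (γ * (α * u + β * w)) ≡⟨ cong₂ (λ x y → α * x + - (γ * y)) γδ αβ ⟩
    α * 0# + - (γ * 0#)                          ≡⟨ x*0-y*0≡0 α γ ⟩
    0#                                           ∎)

  det≡0⇒same-annihilators : ∀ {α β γ δ u w} → det α β γ δ ≡ 0# → γ * u + δ * w ≡ 0# →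
    NotBothZero γ δ → α * u + β * w ≡ 0#
  det≡0⇒same-annihilators {α} {β} {γ} {δ} {u} {w} D≡0 γδ γ,δ≢0 with nonzeroComponent γ,δ≢0
  ... | inj₁ γ≢0 = x*y≡0⇒y≡0 γ≢0 (begin
    γ * (α * u + β * w)                          ≡⟨ solve 6 (λ α β γ δ u w →
                                                      γ :* (α :* u :+ β :* w)
                                                      := α :* (γ :* u :+ δ :* w) :+ :- (w :* (α :* δ :+ :- (β :* γ))))
                                                    refl α β γ δ u w ⟩
    α * (γ * u + δ * w) + - (w * det α β γ δ)    ≡⟨ cong₂ (λ x y → α * x + - (w * y)) γδ D≡0 ⟩
    α * 0# + - (w * 0#)                          ≡⟨ x*0-y*0≡0 α w ⟩
    0#                                           ∎)
  ... | inj₂ δ≢0 = x*y≡0⇒y≡0 δ≢0 (begin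
    δ * (α * u + β * w)                          ≡⟨ solve 6 (λ α β γ δ u w →
                                                      δ :* (α :* u :+ β :* w)
                                                      := β :* (γ :* u :+ δ :* w) :+ u :* (α :* δ :+ :- (β :* γ)))
                                                    refl α β γ δ u w ⟩
    β * (γ * u + δ * w) + u * det α β γ δ        ≡⟨ cong₂ (λ x y → β * x + u * y) γδ D≡0 ⟩
    β * 0# + u * 0#                              ≡⟨ x*0+y*0≡0 β u ⟩
    0#                                           ∎)

  b+ta≡0-unique : ∀ {a b t t'} → a ≢ 0# → b + t * a ≡ 0# → b + t' * a ≡ 0# → t ≡ t'
  b+ta≡0-unique {a} {b} {t} {t'} a≢0 bta≡0 bt'a≡0 = begin
    t               ≡⟨ solve 2 (λ t t' → t := (t :+ :- t') :+ t') refl t t' ⟩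
    (t + - t') + t' ≡⟨ cong (_+ t') t-t'≡0 ⟩
    0# + t'         ≡⟨ +-identityˡ t' ⟩
    t'              ∎
    where
    t-t'≡0 : t + - t' ≡ 0#
    t-t'≡0 = x*y≡0⇒x≡0 a≢0 (begin
      (t + - t') * a                ≡⟨ solve 4 (λ t t' a b → (t :+ :- t') :* a := (b :+ t :* a) :+ :- (b :+ t' :* a))
                                         refl t t' a b ⟩
      (b + t * a) + - (b + t' * a)  ≡⟨ cong₂ (λ x y → x + - y) bta≡0 bt'a≡0 ⟩
      0# + - 0#                     ≡⟨ -‿inverseʳ 0# ⟩
      0#                            ∎)

module LinearAlgebra {q : ℕ} (F : FiniteField q) where
  open FieldArithmetic F
  open ≡.≡-Reasoning

  V : ℕ → Set
  V d = Fin d → Fin q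

  infix 4 _≋_
  infixl 6 _⊕_
  infixr 7 _·_

  _≋_ : ∀ {d} → V d → V d → Set
  u ≋ v = ∀ i → u i ≡ v i

  𝟎 : ∀ {d} → V d
  𝟎 _ = 0#

  _⊕_ : ∀ {d} → V d → V d → V d
  (u ⊕ v) i = u i + v i

  _·_ : ∀ {d} → Fin q → V d → V d
  (c · v) i = c * v i

  basis : ∀ {d} → Fin d → V d
  basis fzero    = 1# ∷ 𝟎
  basis (fsuc i) = 0# ∷ basis i

  NonZeroVec : ∀ {d} → V d → Set
  NonZeroVec v = ¬ (v ≋ 𝟎)

  dot : ∀ {d} → V d → V d → Fin q
  dot {zero}  a x = 0#
  dot {suc d} a x = head a * head x + dot (tail a) (tail x)

  dot-comm : ∀ {d} (a x : V d) → dot a x ≡ dot x a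
  dot-comm {zero}  a x = refl
  dot-comm {suc d} a x = cong₂ _+_ (*-comm (head a) (head x)) (dot-comm (tail a) (tail x))

  dot-congʳ : ∀ {d} (a : V d) {x y} → x ≋ y → dot a x ≡ dot a y
  dot-congʳ {zero}  a x≋y = refl
  dot-congʳ {suc d} a x≋y = cong₂ (λ u v → head a * u + v) (x≋y fzero) (dot-congʳ (tail a) (x≋y ∘ fsuc))

  dot-𝟎ʳ : ∀ {d} (a : V d) → dot a 𝟎 ≡ 0#
  dot-𝟎ʳ {zero}  a = refl
  dot-𝟎ʳ {suc d} a = trans (cong₂ _+_ (zeroʳ (head a)) (dot-𝟎ʳ (tail a))) (+-identityʳ 0#)

  dot-⊕ʳ : ∀ {d} (a x y : V d) → dot a (x ⊕ y) ≡ dot a x + dot a y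
  dot-⊕ʳ {zero}  a x y = sym (+-identityʳ 0#)
  dot-⊕ʳ {suc d} a x y = begin
    head a * (head x + head y) + dot (tail a) (tail x ⊕ tail y)
      ≡⟨ cong ((head a * (head x + head y)) +_) (dot-⊕ʳ (tail a) (tail x) (tail y)) ⟩
    head a * (head x + head y) + (dot (tail a) (tail x) + dot (tail a) (tail y))
      ≡⟨ solve 5 (λ a x y X Y → a :* (x :+ y) :+ (X :+ Y) := (a :* x :+ X) :+ (a :* y :+ Y))
           refl (head a) (head x) (head y) _ _ ⟩
    (head a * head x + dot (tail a) (tail x)) + (head a * head y + dot (tail a) (tail y))
      ∎

  dot-·ʳ : ∀ {d} (a : V d) c x → dot a (c · x) ≡ c * dot a x
  dot-·ʳ {zero}  a c x = sym (zeroʳ c)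
  dot-·ʳ {suc d} a c x = begin
    head a * (c * head x) + dot (tail a) (c · tail x)
      ≡⟨ cong ((head a * (c * head x)) +_) (dot-·ʳ (tail a) c (tail x)) ⟩
    head a * (c * head x) + c * dot (tail a) (tail x)
      ≡⟨ solve 4 (λ a c x X → a :* (c :* x) :+ c :* X := c :* (a :* x :+ X)) refl (head a) c (head x) _ ⟩
    c * (head a * head x + dot (tail a) (tail x))
      ∎

  dot-⊕ˡ : ∀ {d} (a b x : V d) → dot (a ⊕ b) x ≡ dot a x + dot b x
  dot-⊕ˡ a b x = trans (dot-comm (a ⊕ b) x)
    (trans (dot-⊕ʳ x a b) (cong₂ _+_ (dot-comm x a) (dot-comm x b)))

  dot-·ˡ : ∀ {d} c (a x : V d) → dot (c · a) x ≡ c * dot a x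
  dot-·ˡ c a x = trans (dot-comm (c · a) x) (trans (dot-·ʳ x c a) (cong (c *_) (dot-comm x a)))

  dot-combinationʳ : ∀ {d} (a : V d) α β u w → dot a (α · u ⊕ β · w) ≡ α * dot a u + β * dot a w
  dot-combinationʳ a α β u w = trans (dot-⊕ʳ a (α · u) (β · w)) (cong₂ _+_ (dot-·ʳ a α u) (dot-·ʳ a β w))

  dot-basisʳ : ∀ {d} (a : V d) i → dot a (basis i) ≡ a i
  dot-basisʳ {suc d} a fzero =
    trans (cong₂ _+_ (*-identityʳ (head a)) (dot-𝟎ʳ (tail a))) (+-identityʳ (head a))
  dot-basisʳ {suc d} a (fsuc i) =
    trans (cong₂ _+_ (zeroʳ (head a)) (dot-basisʳ (tail a) i)) (+-identityˡ (a (fsuc i)))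

  dot-basisˡ : ∀ {d} i (x : V d) → dot (basis i) x ≡ x i
  dot-basisˡ i x = trans (dot-comm (basis i) x) (dot-basisʳ x i)

  data Span {d} (P : V d → Set) : V d → Set where
    gen : ∀ {v} → P v → Span P v
    zer : Span P 𝟎
    add : ∀ {u v} → Span P u → Span P v → Span P (u ⊕ v)
    scl : ∀ {v} c → Span P v → Span P (c · v)
    ext : ∀ {u v} → u ≋ v → Span P u → Span P v

  Span-mono : ∀ {d} {P Q : V d → Set} → (∀ {x} → P x → Span Q x) → ∀ {v} → Span P v → Span Q v
  Span-mono P⊆Q (gen p)   = P⊆Q p
  Span-mono P⊆Q zer       = zer
  Span-mono P⊆Q (add s t) = add (Span-mono P⊆Q s) (Span-mono P⊆Q t)
  Span-mono P⊆Q (scl c s) = scl c (Span-mono P⊆Q s)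
  Span-mono P⊆Q (ext e s) = ext e (Span-mono P⊆Q s)

  OneOf : ∀ {d n} → (Fin n → V d) → V d → Set
  OneOf x v = Σ _ λ i → v ≋ x i

  Spans : ∀ {d n} → (Fin n → V d) → Set
  Spans x = ∀ v → Span (OneOf x) v

  Annihilates : ∀ {d n} → V d → (Fin n → V d) → Set
  Annihilates a x = ∀ i → dot a (x i) ≡ 0#

  Annihilator : ∀ {d n} → (Fin n → V d) → Set
  Annihilator x = Σ _ λ a → NonZeroVec a × Annihilates a x

  module Pivot {d n} (x : Fin (suc n) → V (suc d)) (i₀ : Fin (suc n)) (p≢0 : head (x i₀) ≢ 0#) where
    p p⁻¹ : Fin q
    p = head (x i₀)
    p⁻¹ = proj₁ (inverse p p≢0)

    pp⁻¹≡1 : p * p⁻¹ ≡ 1#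
    pp⁻¹≡1 = proj₂ (inverse p p≢0)

    z-zp⁻¹p≡0 : ∀ z → z + - (z * p⁻¹) * p ≡ 0#
    z-zp⁻¹p≡0 z = begin
      z + - (z * p⁻¹) * p    ≡⟨ solve 3 (λ z p p⁻¹ → z :+ :- (z :* p⁻¹) :* p := z :+ :- (z :* (p :* p⁻¹)))
                                  refl z p p⁻¹ ⟩
      z + - (z * (p * p⁻¹))  ≡⟨ cong (λ t → z + - (z * t)) pp⁻¹≡1 ⟩
      z + - (z * 1#)         ≡⟨ cong (λ t → z + - t) (*-identityʳ z) ⟩
      z + - z                ≡⟨ -‿inverseʳ z ⟩
      0#                     ∎

    eliminate : V (suc d) → V (suc d)
    eliminate v = v ⊕ (- (head v * p⁻¹)) · x i₀

    head-eliminate : ∀ v → head (eliminate v) ≡ 0#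
    head-eliminate v = z-zp⁻¹p≡0 (head v)

    others : Fin n → V (suc d)
    others j = x (punchIn i₀ j)

    reduced : Fin n → V d
    reduced j = tail (eliminate (others j))

    extendAnnihilator : Annihilator reduced → Annihilator x
    extendAnnihilator (a' , a'≢0 , a'-kills) = a , a≢0 , a-kills
      where
      a : V (suc d)
      a = (- (dot a' (tail (x i₀)) * p⁻¹)) ∷ a'

      a≢0 : NonZeroVec a
      a≢0 a≋0 = a'≢0 (a≋0 ∘ fsuc)

      a-kills-pivot : dot a (x i₀) ≡ 0#
      a-kills-pivot = trans (+-comm _ _) (z-zp⁻¹p≡0 (dot a' (tail (x i₀))))

      a-kills-others : ∀ j → dot a (others j) ≡ 0#
      a-kills-others j = begin
        dot a (others j)                          ≡⟨ +-identityʳ _ ⟨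
        dot a (others j) + 0#                     ≡⟨ cong (dot a (others j) +_) (zeroʳ c) ⟨
        dot a (others j) + c * 0#                 ≡⟨ cong (λ t → dot a (others j) + c * t) a-kills-pivot ⟨
        dot a (others j) + c * dot a (x i₀)       ≡⟨ cong (dot a (others j) +_) (dot-·ʳ a c (x i₀)) ⟨
        dot a (others j) + dot a (c · x i₀)       ≡⟨ dot-⊕ʳ a (others j) (c · x i₀) ⟨
        dot a (eliminate (others j))              ≡⟨ cong₂ (λ u v → head a * u + v)
                                                       (head-eliminate (others j)) (a'-kills j) ⟩
        head a * 0# + 0#                          ≡⟨ trans (+-identityʳ _) (zeroʳ (head a)) ⟩
        0#                                        ∎
        where
        c = - (head (others j) * p⁻¹)

      a-kills : Annihilates a x
      a-kills i with i₀ Fin.≟ i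
      ... | yes refl = a-kills-pivot
      ... | no i₀≢i =
        subst (λ t → dot a (x t) ≡ 0#) (FinP.punchIn-punchOut i₀≢i) (a-kills-others (punchOut i₀≢i))

    liftSpans : Spans reduced → Spans x
    liftSpans reduced-spans v =
      ext v≋ (add (Span-mono eliminated∈span (lift (reduced-spans (tail w)))) (scl μ (gen (i₀ , λ _ → refl))))
      where
      lift : ∀ {u} → Span (OneOf reduced) u → Span (OneOf (eliminate ∘ others)) (0# ∷ u)
      lift (gen (j , u≋)) = gen (j , λ { fzero → sym (head-eliminate (others j)) ; (fsuc k) → u≋ k })
      lift zer            = ext (λ { fzero → refl ; (fsuc k) → refl }) zer
      lift (add s t)      = ext (λ { fzero → +-identityʳ 0# ; (fsuc k) → refl }) (add (lift s) (lift t))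
      lift (scl c s)      = ext (λ { fzero → zeroʳ c ; (fsuc k) → refl }) (scl c (lift s))
      lift (ext u≋v s)    = ext (λ { fzero → refl ; (fsuc k) → u≋v k }) (lift s)

      eliminated∈span : ∀ {w} → OneOf (eliminate ∘ others) w → Span (OneOf x) w
      eliminated∈span (j , w≋) =
        ext (λ i → sym (w≋ i)) (add (gen (punchIn i₀ j , λ _ → refl)) (scl _ (gen (i₀ , λ _ → refl))))

      μ : Fin q
      μ = head v * p⁻¹
      w : V (suc d)
      w = eliminate v

      v≋ : (0# ∷ tail w) ⊕ μ · x i₀ ≋ v
      v≋ fzero = begin
        0# + μ * p          ≡⟨ +-identityˡ (μ * p) ⟩
        (head v * p⁻¹) * p  ≡⟨ solve 3 (λ v p p⁻¹ → (v :* p⁻¹) :* p := v :* (p :* p⁻¹)) refl (head v) p p⁻¹ ⟩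
        head v * (p * p⁻¹)  ≡⟨ cong (head v *_) pp⁻¹≡1 ⟩
        head v * 1#         ≡⟨ *-identityʳ (head v) ⟩
        head v              ∎
      v≋ (fsuc k) = solve 3 (λ v μ x → (v :+ :- μ :* x) :+ μ :* x := v) refl (v (fsuc k)) μ (x i₀ (fsuc k))

  annihilatorOrSpans : ∀ {d n} (x : Fin n → V d) → Annihilator x ⊎ (d ℕ.≤ n × Spans x)
  annihilatorOrSpans {zero} x = inj₂ (z≤n , λ v → ext (λ ()) zer)
  annihilatorOrSpans {suc d} x with FinP.all? (λ i → head (x i) ≟ 0#)
  ... | yes heads≡0 =
    inj₁ (basis fzero , (λ e₀≋0 → 1≢0 (e₀≋0 fzero)) , λ i → trans (dot-basisˡ fzero (x i)) (heads≡0 i))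
  ... | no heads≢0 with FinP.¬∀⟶∃¬ _ _ (λ i → head (x i) ≟ 0#) heads≢0
  annihilatorOrSpans {suc d} {zero} x | no _ | () , _
  annihilatorOrSpans {suc d} {suc n} x | no _ | i₀ , p≢0 with annihilatorOrSpans (Pivot.reduced x i₀ p≢0)
  ... | inj₁ annihilator = inj₁ (Pivot.extendAnnihilator x i₀ p≢0 annihilator)
  ... | inj₂ (d≤n , spans) = inj₂ (s≤s d≤n , Pivot.liftSpans x i₀ p≢0 spans)

  annihilator-exists : ∀ {d n} (x : Fin n → V d) → n ℕ.< d → Annihilator x
  annihilator-exists x n<d with annihilatorOrSpans x
  ... | inj₁ annihilator = annihilator
  ... | inj₂ (d≤n , _) = ⊥-elim (ℕP.<⇒≱ n<d d≤n)

  pencilHyperplane-not-contained : ∀ {d} (a b : V d) {i j} → a i ≢ 0# → b i ≡ 0# → b j ≢ 0# → ∀ t →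
    let c = b ⊕ t · a in NonZeroVec c × Σ (V d) λ v → dot c v ≡ 0# × dot a v ≢ 0#
  pencilHyperplane-not-contained a b {i} {j} aᵢ≢0 bᵢ≡0 bⱼ≢0 t = c≢0 , v , c·v≡0 , a·v≢0
    where
    c = b ⊕ t · a
    v = c j · basis i ⊕ (- c i) · basis j

    a·v : dot a v ≡ c j * a i + - c i * a j
    a·v = trans (dot-combinationʳ a (c j) (- c i) (basis i) (basis j))
                (cong₂ (λ x y → c j * x + - c i * y) (dot-basisʳ a i) (dot-basisʳ a j))

    c·v≡0 : dot c v ≡ 0#
    c·v≡0 = begin
      dot c v
        ≡⟨ dot-combinationʳ c (c j) (- c i) (basis i) (basis j) ⟩
      c j * dot c (basis i) + - c i * dot c (basis j)
        ≡⟨ cong₂ (λ x y → c j * x + - c i * y) (dot-basisʳ c i) (dot-basisʳ c j) ⟩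
      c j * c i + - c i * c j
        ≡⟨ solve 2 (λ x y → x :* y :+ :- y :* x := x :* y :+ :- (x :* y)) refl (c j) (c i) ⟩
      c j * c i + - (c j * c i)
        ≡⟨ -‿inverseʳ _ ⟩
      0# ∎

    a·v≡bⱼaᵢ : dot a v ≡ b j * a i
    a·v≡bⱼaᵢ = begin
      dot a v
        ≡⟨ a·v ⟩
      (b j + t * a j) * a i + - (b i + t * a i) * a j
        ≡⟨ cong (λ x → (b j + t * a j) * a i + - x * a j) (trans (cong (_+ t * a i) bᵢ≡0) (+-identityˡ _)) ⟩
      (b j + t * a j) * a i + - (t * a i) * a j
        ≡⟨ solve 4 (λ bⱼ t aⱼ aᵢ → (bⱼ :+ t :* aⱼ) :* aᵢ :+ :- (t :* aᵢ) :* aⱼ := bⱼ :* aᵢ) refl (b j) t (a j) (a i) ⟩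
      b j * a i ∎

    a·v≢0 : dot a v ≢ 0#
    a·v≢0 a·v≡0 = bⱼ≢0 (x*y≡0⇒x≡0 aᵢ≢0 (trans (sym a·v≡bⱼaᵢ) a·v≡0))

    c≢0 : NonZeroVec c
    c≢0 c≋0 = a·v≢0 (begin
      dot a v                  ≡⟨ a·v ⟩
      c j * a i + - c i * a j  ≡⟨ cong₂ (λ x y → x * a i + - y * a j) (c≋0 j) (c≋0 i) ⟩
      0# * a i + - 0# * a j    ≡⟨ cong (λ x → 0# * a i + x * a j) -0≡0 ⟩
      0# * a i + 0# * a j      ≡⟨ trans (cong₂ _+_ (zeroˡ (a i)) (zeroˡ (a j))) (+-identityʳ 0#) ⟩
      0#                       ∎)

complementOfInjection : ∀ {m k} (σ : Fin m → Fin k) → Injective _≡_ _≡_ σ →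
  Σ (Fin (k ℕ.∸ m) → Fin k) λ ρ → ∀ i → (Σ (Fin m) λ j → σ j ≡ i) ⊎ (Σ (Fin (k ℕ.∸ m)) λ s → ρ s ≡ i)
complementOfInjection {zero} σ σ-inj = (λ i → i) , λ i → inj₂ (i , refl)
complementOfInjection {suc m} {zero} σ σ-inj with σ fzero
... | ()
complementOfInjection {suc m} {suc k} σ σ-inj = ρ , covers
  where
  σ₀≢σ : ∀ j → σ fzero ≢ σ (fsuc j)
  σ₀≢σ j σ₀≡σⱼ with σ-inj σ₀≡σⱼ
  ... | ()

  σ' : Fin m → Fin k
  σ' j = punchOut (σ₀≢σ j)

  σ'-inj : Injective _≡_ _≡_ σ'
  σ'-inj {j} {j'} eq = FinP.suc-injective (σ-inj (FinP.punchOut-injective (σ₀≢σ j) (σ₀≢σ j') eq))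

  ρ' = proj₁ (complementOfInjection σ' σ'-inj)
  covers' = proj₂ (complementOfInjection σ' σ'-inj)

  ρ : Fin (k ℕ.∸ m) → Fin (suc k)
  ρ s = punchIn (σ fzero) (ρ' s)

  covers : ∀ i → (Σ (Fin (suc m)) λ j → σ j ≡ i) ⊎ (Σ (Fin (k ℕ.∸ m)) λ s → ρ s ≡ i)
  covers i with σ fzero Fin.≟ i
  ... | yes σ₀≡i = inj₁ (fzero , σ₀≡i)
  ... | no σ₀≢i with covers' (punchOut σ₀≢i)
  ...   | inj₁ (j , eq) = inj₁ (fsuc j , trans (sym (FinP.punchIn-punchOut (σ₀≢σ j)))
                                         (trans (cong (punchIn (σ fzero)) eq) (FinP.punchIn-punchOut σ₀≢i)))
  ...   | inj₂ (s , eq) = inj₂ (s , trans (cong (punchIn (σ fzero)) eq) (FinP.punchIn-punchOut σ₀≢i))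

valueAvoidingAll : ∀ {q r} → r ℕ.< q → (Excludes : Fin q → Fin r → Set) → (∀ t s → Dec (Excludes t s)) →
  (∀ {t t' s} → Excludes t s → Excludes t' s → t ≡ t') → Σ (Fin q) λ t → ∀ s → ¬ Excludes t s
valueAvoidingAll r<q Excludes excludes? unique with FinP.all? (λ t → FinP.any? (excludes? t))
... | no ¬allExcluded with FinP.¬∀⟶∃¬ _ _ (λ t → FinP.any? (excludes? t)) ¬allExcluded
...   | t , ¬excluded = t , λ s e → ¬excluded (s , e)
valueAvoidingAll r<q Excludes excludes? unique | yes allExcluded
  with FinP.pigeonhole r<q (proj₁ ∘ allExcluded)
... | t , t' , t<t' , same =
  ⊥-elim (FinP.<-irrefl (unique (proj₂ (allExcluded t)) (subst (Excludes t') (sym same) (proj₂ (allExcluded t'))))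
                        t<t')

module ProjectiveLines {q : ℕ} (F : FiniteField q) (N : ℕ) where
  open FieldArithmetic F
  open LinearAlgebra F
  open Geometry F N
    using (Vec; Line; OnLine; OnSomeLine; InSpan; InHyperplane; lincomb; HiggledyPiggledy; SpansSpace)
  open Line
  open ≡.≡-Reasoning

  dot-agrees : ∀ n (a x : V n) → Geometry.dot F N n a x ≡ dot a x
  dot-agrees zero    a x = refl
  dot-agrees (suc n) a x = cong (head a * head x +_) (dot-agrees n (tail a) (tail x))

  lincomb-scale : ∀ n c cs xs → lincomb n (λ i → c * cs i) xs ≋ c · lincomb n cs xs
  lincomb-scale zero    c cs xs i = sym (zeroʳ c)
  lincomb-scale (suc n) c cs xs i =
    trans (cong ((c * head cs) * head xs i +_) (lincomb-scale n c (tail cs) (tail xs) i))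
          (solve 4 (λ c b x R → (c :* b) :* x :+ c :* R := c :* (b :* x :+ R)) refl c (head cs) (head xs i) _)

  module _ {P : Vec → Set} where
    InSpan-lincomb-⊕ : ∀ {v} n cs xs → (∀ i → P (xs i)) → InSpan P v → InSpan P (lincomb n cs xs ⊕ v)
    InSpan-lincomb-⊕ zero cs xs _ (m , cs' , xs' , P-xs' , v≋) =
      m , cs' , xs' , P-xs' , λ i → trans (+-identityˡ _) (v≋ i)
    InSpan-lincomb-⊕ (suc n) cs xs P-xs v∈ with InSpan-lincomb-⊕ n (tail cs) (tail xs) (P-xs ∘ fsuc) v∈
    ... | m , cs' , xs' , P-xs' , rest≋ =
      suc m , head cs ∷ cs' , head xs ∷ xs' , (λ { fzero → P-xs fzero ; (fsuc i) → P-xs' i }) ,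
      λ i → trans (+-assoc _ _ _) (cong (head cs * head xs i +_) (rest≋ i))

    Span⇒InSpan : ∀ {v} → Span P v → InSpan P v
    Span⇒InSpan {v} (gen p) = 1 , (λ _ → 1#) , (λ _ → v) , (λ _ → p) ,
      λ i → sym (trans (+-identityʳ _) (*-identityˡ _))
    Span⇒InSpan zer = 0 , (λ ()) , (λ ()) , (λ ()) , λ i → refl
    Span⇒InSpan (add s t) with Span⇒InSpan s
    ... | n , cs , xs , P-xs , u≋ =
      let m , cs' , xs' , P-xs' , w≋ = InSpan-lincomb-⊕ n cs xs P-xs (Span⇒InSpan t)
      in m , cs' , xs' , P-xs' , λ i → trans (cong (_+ _) (u≋ i)) (w≋ i)
    Span⇒InSpan (scl c s) with Span⇒InSpan s
    ... | n , cs , xs , P-xs , v≋ =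
      n , (λ i → c * cs i) , xs , P-xs , λ i → trans (cong (c *_) (v≋ i)) (sym (lincomb-scale n c cs xs i))
    Span⇒InSpan (ext u≋v s) with Span⇒InSpan s
    ... | n , cs , xs , P-xs , u≋ = n , cs , xs , P-xs , λ i → trans (sym (u≋v i)) (u≋ i)

    dot-lincomb≡0 : ∀ a n cs xs → (∀ i → dot a (xs i) ≡ 0#) → dot a (lincomb n cs xs) ≡ 0#
    dot-lincomb≡0 a zero    cs xs _ = dot-𝟎ʳ a
    dot-lincomb≡0 a (suc n) cs xs a·xs≡0 = begin
      dot a (head cs · head xs ⊕ lincomb n (tail cs) (tail xs))
        ≡⟨ dot-⊕ʳ a (head cs · head xs) (lincomb n (tail cs) (tail xs)) ⟩
      dot a (head cs · head xs) + dot a (lincomb n (tail cs) (tail xs))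
        ≡⟨ cong₂ _+_ (trans (dot-·ʳ a (head cs) (head xs)) (cong (head cs *_) (a·xs≡0 fzero)))
                     (dot-lincomb≡0 a n (tail cs) (tail xs) (a·xs≡0 ∘ fsuc)) ⟩
      head cs * 0# + 0#
        ≡⟨ trans (+-identityʳ _) (zeroʳ (head cs)) ⟩
      0# ∎

    InSpan-annihilated : ∀ a {v} → (∀ {x} → P x → dot a x ≡ 0#) → InSpan P v → dot a v ≡ 0#
    InSpan-annihilated a a·P≡0 (n , cs , xs , P-xs , v≋) =
      trans (dot-congʳ a v≋) (dot-lincomb≡0 a n cs xs (a·P≡0 ∘ P-xs))

  LineIn : Vec → Line → Set
  LineIn a l = dot a (u l) ≡ 0# × dot a (w l) ≡ 0#

  lineIn? : ∀ a l → Dec (LineIn a l)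
  lineIn? a l = (dot a (u l) ≟ 0#) ×-dec (dot a (w l) ≟ 0#)

  onLine-u : ∀ l → OnLine (u l) l
  onLine-u l = u≢0 , 1# , 0# , λ i → sym (trans (cong₂ _+_ (*-identityˡ _) (zeroˡ _)) (+-identityʳ _))
    where
    u≢0 : NonZeroVec (u l)
    u≢0 u≋0 = 1≢0 (proj₁ (indep l 1# 0# λ i →
      trans (cong₂ _+_ (trans (*-identityˡ _) (u≋0 i)) (zeroˡ _)) (+-identityʳ 0#)))

  onLine-w : ∀ l → OnLine (w l) l
  onLine-w l = w≢0 , 0# , 1# , λ i → sym (trans (cong₂ _+_ (zeroˡ _) (*-identityˡ _)) (+-identityˡ _))
    where
    w≢0 : NonZeroVec (w l)
    w≢0 w≋0 = 1≢0 (proj₂ (indep l 0# 1# λ i →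
      trans (cong₂ _+_ (zeroˡ _) (trans (*-identityˡ _) (w≋0 i))) (+-identityʳ 0#)))

  dot-onLine : ∀ x l → OnLine x l →
    Σ (Fin q) λ α → Σ (Fin q) λ β → ∀ e → dot e x ≡ α * dot e (u l) + β * dot e (w l)
  dot-onLine x l (_ , α , β , x≋) = α , β , λ e → trans (dot-congʳ e x≋) (dot-combinationʳ e α β (u l) (w l))

  LineIn⇒pointsIn : ∀ a x l → LineIn a l → OnLine x l → dot a x ≡ 0#
  LineIn⇒pointsIn a x l (a·u≡0 , a·w≡0) x∈l =
    let α , β , dot-x = dot-onLine x l x∈l in
    trans (dot-x a) (trans (cong₂ (λ y z → α * y + β * z) a·u≡0 a·w≡0) (x*0+y*0≡0 α β))

  lineMeetsHyperplane : ∀ a l → Σ (Fin q) λ γ → Σ (Fin q) λ δ →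
    NotBothZero γ δ × dot a (γ · u l ⊕ δ · w l) ≡ 0#
  lineMeetsHyperplane a l with dot a (u l) ≟ 0#
  ... | yes a·u≡0 = 1# , 0# , (λ (1≡0 , _) → 1≢0 1≡0) , (begin
    dot a (1# · u l ⊕ 0# · w l)           ≡⟨ dot-combinationʳ a 1# 0# (u l) (w l) ⟩
    1# * dot a (u l) + 0# * dot a (w l)   ≡⟨ cong₂ _+_ (trans (*-identityˡ _) a·u≡0) (zeroˡ _) ⟩
    0# + 0#                               ≡⟨ +-identityʳ 0# ⟩
    0#                                    ∎)
  ... | no a·u≢0 = dot a (w l) , - dot a (u l) , (λ (_ , -a·u≡0) → -x≢0 a·u≢0 -a·u≡0) , (begin
    dot a (dot a (w l) · u l ⊕ - dot a (u l) · w l)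
      ≡⟨ dot-combinationʳ a _ _ (u l) (w l) ⟩
    dot a (w l) * dot a (u l) + - dot a (u l) * dot a (w l)
      ≡⟨ solve 2 (λ x y → y :* x :+ :- x :* y := x :* y :+ :- (x :* y)) refl (dot a (u l)) (dot a (w l)) ⟩
    dot a (u l) * dot a (w l) + - (dot a (u l) * dot a (w l))
      ≡⟨ -‿inverseʳ _ ⟩
    0# ∎)

  -- A line not contained in the hyperplane c meets it in a single point.
  lineMeetsHyperplaneOnce : ∀ c a l γ δ → ¬ LineIn c l → NotBothZero γ δ →
    let p = γ · u l ⊕ δ · w l in dot c p ≡ 0# → dot a p ≡ 0# →
    ∀ x → OnLine x l → dot c x ≡ 0# → dot a x ≡ 0#
  lineMeetsHyperplaneOnce c a l γ δ l⊈c γ,δ≢0 c·p≡0 a·p≡0 x x∈l c·x≡0 =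
    trans (dot-x a) (det≡0⇒same-annihilators D≡0 (onLine-combination a a·p≡0) γ,δ≢0)
    where
    α = proj₁ (dot-onLine x l x∈l)
    β = proj₁ (proj₂ (dot-onLine x l x∈l))
    dot-x : ∀ e → dot e x ≡ α * dot e (u l) + β * dot e (w l)
    dot-x = proj₂ (proj₂ (dot-onLine x l x∈l))

    onLine-combination : ∀ e → dot e (γ · u l ⊕ δ · w l) ≡ 0# → γ * dot e (u l) + δ * dot e (w l) ≡ 0#
    onLine-combination e e·p≡0 = trans (sym (dot-combinationʳ e γ δ (u l) (w l))) e·p≡0

    D≡0 : det α β γ δ ≡ 0#
    D≡0 = det≡0-of-kernel (trans (sym (dot-x c)) c·x≡0) (onLine-combination c c·p≡0) l⊈c

  module _ {k m r} (L : Fin k → Line) (hp : HiggledyPiggledy L) (σ : Fin m → Fin k) (ρ : Fin r → Fin k)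
           (covers : ∀ i → (Σ (Fin m) λ j → σ j ≡ i) ⊎ (Σ (Fin r) λ s → ρ s ≡ i))
           (r<N : r ℕ.< N) (r<q : r ℕ.< q) where

    module _ (a : Vec) where
      meet : ∀ s → Σ (Fin q) λ γ → Σ (Fin q) λ δ →
        NotBothZero γ δ × dot a (γ · u (L (ρ s)) ⊕ δ · w (L (ρ s))) ≡ 0#
      meet s = lineMeetsHyperplane a (L (ρ s))

      γ δ : Fin r → Fin q
      γ s = proj₁ (meet s)
      δ s = proj₁ (proj₂ (meet s))

      γ,δ≢0 : ∀ s → NotBothZero (γ s) (δ s)
      γ,δ≢0 s = proj₁ (proj₂ (proj₂ (meet s)))

      meetingPoint : Fin r → Vec
      meetingPoint s = γ s · u (L (ρ s)) ⊕ δ s · w (L (ρ s))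

      a·meetingPoint≡0 : ∀ s → dot a (meetingPoint s) ≡ 0#
      a·meetingPoint≡0 s = proj₂ (proj₂ (proj₂ (meet s)))

      module _ (b : Vec) where
        pencil : Fin q → Vec
        pencil t = b ⊕ t · a

        dot-pencil : ∀ t x → dot (pencil t) x ≡ dot b x + t * dot a x
        dot-pencil t x = trans (dot-⊕ˡ b (t · a) x) (cong (dot b x +_) (dot-·ˡ t a x))

        Captures : Fin q → Fin r → Set
        Captures t s = LineIn (pencil t) (L (ρ s)) × ¬ LineIn a (L (ρ s))

        captures? : ∀ t s → Dec (Captures t s)
        captures? t s = lineIn? (pencil t) (L (ρ s)) ×-dec ¬? (lineIn? a (L (ρ s)))

        captures-unique : ∀ {t t' s} → Captures t s → Captures t' s → t ≡ t'
        captures-unique {t} {t'} {s} ((c·u≡0 , c·w≡0) , l⊈a) ((c'·u≡0 , c'·w≡0) , _)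
          with dot a (u (L (ρ s))) ≟ 0# | dot a (w (L (ρ s))) ≟ 0#
        ... | no a·u≢0 | _ = b+ta≡0-unique a·u≢0
          (trans (sym (dot-pencil t (u (L (ρ s))))) c·u≡0) (trans (sym (dot-pencil t' (u (L (ρ s))))) c'·u≡0)
        ... | yes _ | no a·w≢0 = b+ta≡0-unique a·w≢0
          (trans (sym (dot-pencil t (w (L (ρ s))))) c·w≡0) (trans (sym (dot-pencil t' (w (L (ρ s))))) c'·w≡0)
        ... | yes a·u≡0 | yes a·w≡0 = ⊥-elim (l⊈a (a·u≡0 , a·w≡0))

        pencil∩lines⊆a : (∀ j → LineIn a (L (σ j))) → (∀ s → dot b (meetingPoint s) ≡ 0#) →
          ∀ t → (∀ s → ¬ Captures t s) → ∀ x → OnSomeLine L x → dot (pencil t) x ≡ 0# → dot a x ≡ 0#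
        pencil∩lines⊆a σ⊆a b·point≡0 t noCapture x (i , x∈Lᵢ) c·x≡0 with covers i
        ... | inj₁ (j , refl) = LineIn⇒pointsIn a x (L (σ j)) (σ⊆a j) x∈Lᵢ
        ... | inj₂ (s , refl) with lineIn? a (L (ρ s))
        ...   | yes l⊆a = LineIn⇒pointsIn a x (L (ρ s)) l⊆a x∈Lᵢ
        ...   | no l⊈a = lineMeetsHyperplaneOnce (pencil t) a (L (ρ s)) (γ s) (δ s)
                  (λ l⊆c → noCapture s (l⊆c , l⊈a)) (γ,δ≢0 s) c·point≡0 (a·meetingPoint≡0 s) x x∈Lᵢ c·x≡0
          where
          c·point≡0 : dot (pencil t) (meetingPoint s) ≡ 0#
          c·point≡0 = begin
            dot (pencil t) (meetingPoint s)                      ≡⟨ dot-pencil t (meetingPoint s) ⟩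
            dot b (meetingPoint s) + t * dot a (meetingPoint s)  ≡⟨ cong₂ (λ x y → x + t * y) (b·point≡0 s)
                                                                                    (a·meetingPoint≡0 s) ⟩
            0# + t * 0#                                          ≡⟨ trans (+-identityˡ _) (zeroʳ t) ⟩
            0#                                                   ∎

    noHyperplaneContainsSelection : ∀ a → NonZeroVec a → (∀ j → LineIn a (L (σ j))) → ⊥
    noHyperplaneContainsSelection a a≢0 σ⊆a =
      let i₀ , aᵢ₀≢0 = FinP.¬∀⟶∃¬ _ _ (λ i → a i ≟ 0#) a≢0
          b , b≢0 , b-kills = annihilator-exists (basis i₀ ∷ meetingPoint a) (s≤s r<N)
          j₀ , bⱼ₀≢0 = FinP.¬∀⟶∃¬ _ _ (λ i → b i ≟ 0#) b≢0
          bᵢ₀≡0 = trans (sym (dot-basisʳ b i₀)) (b-kills fzero)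
          t , noCapture = valueAvoidingAll r<q (Captures a b) (captures? a b) (captures-unique a b)
          c = pencil a b t
          c≢0 , v , c·v≡0 , a·v≢0 = pencilHyperplane-not-contained a b aᵢ₀≢0 bᵢ₀≡0 bⱼ₀≢0 t
      in a·v≢0 (InSpan-annihilated {P = λ x → OnSomeLine L x × InHyperplane c x} a
           (λ {x} (x∈L , x∈c) → pencil∩lines⊆a a b σ⊆a (b-kills ∘ fsuc) t noCapture x x∈L
                                   (trans (sym (dot-agrees (suc N) c x)) x∈c))
           (hp c c≢0 v (trans (dot-agrees (suc N) c v) c·v≡0)))

    endpoints : Fin (m ℕ.+ m) → Vec
    endpoints = (u ∘ L ∘ σ) ++ (w ∘ L ∘ σ)

    endpoint-onLine : ∀ i → OnSomeLine (L ∘ σ) (endpoints i)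
    endpoint-onLine i = onLine (Fin.splitAt m i)
      where
      onLine : ∀ s → OnSomeLine (L ∘ σ) ([ u ∘ L ∘ σ , w ∘ L ∘ σ ] s)
      onLine (inj₁ j) = j , onLine-u (L (σ j))
      onLine (inj₂ j) = j , onLine-w (L (σ j))

    selectionSpans : SpansSpace (L ∘ σ)
    selectionSpans v with annihilatorOrSpans endpoints
    ... | inj₂ (_ , spans) =
      Span⇒InSpan (Span-mono {Q = OnSomeLine (L ∘ σ)}
                             (λ (i , v≋) → ext (λ t → sym (v≋ t)) (gen (endpoint-onLine i))) (spans v))
    ... | inj₁ (a , a≢0 , a-kills) = ⊥-elim (noHyperplaneContainsSelection a a≢0 λ j →
      trans (cong (dot a) (sym (lookup-++ˡ (u ∘ L ∘ σ) (w ∘ L ∘ σ) j))) (a-kills (j Fin.↑ˡ m)) ,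
      trans (cong (dot a) (sym (lookup-++ʳ (u ∘ L ∘ σ) (w ∘ L ∘ σ) j))) (a-kills (m Fin.↑ʳ j)))

[n+2]/2≡1+n/2 : ∀ n → (n ℕ.+ 2) ℕ./ 2 ≡ suc (n ℕ./ 2)
[n+2]/2≡1+n/2 n = trans (m/n≡1+[m∸n]/n (ℕP.m≤n+m 2 n)) (cong (λ t → suc (t ℕ./ 2)) (ℕP.m+n∸n≡m n 2))

-- The lines outside a selection of ⌈(N+1)/2⌉ among N + ⌊N/2⌋ lines number N - 1.
complementSize : ∀ n → (suc n ℕ.+ suc n ℕ./ 2) ℕ.∸ (suc n ℕ.+ 2) ℕ./ 2 ≡ n
complementSize n =
  trans (cong ((suc n ℕ.+ suc n ℕ./ 2) ℕ.∸_) ([n+2]/2≡1+n/2 (suc n))) (ℕP.m+n∸n≡m n (suc n ℕ./ 2))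

open import Data.Nat using (_+_; _/_; _≤_)

mainTheorem17 : (N q : ℕ) → 1 ≤ N → IsPrimePower q → (F : FiniteField q) →
    let open Geometry F N in
    (k : ℕ) → (L : Fin k → Line) → Distinct L → HiggledyPiggledy L →
    k ≡ N + N / 2 → k ≤ q →
    (σ : Fin ((N + 2) / 2) → Fin k) → Injective _≡_ _≡_ σ →
    SpansSpace (λ i → L (σ i))
mainTheorem17 zero _ () _ _ _ _ _ _ _ _ _ _
mainTheorem17 (suc N) q _ _ F k L _ hp k≡ k≤q σ σ-inj =
  ProjectiveLines.selectionSpans F (suc N) L hp σ ρ covers (s≤s r≤N) (ℕP.≤-trans (s≤s r≤N) N<q)
  where
  ρ = proj₁ (complementOfInjection σ σ-inj)
  covers = proj₂ (complementOfInjection σ σ-inj)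

  r≤N : k ℕ.∸ (suc N + 2) / 2 ≤ N
  r≤N = ℕP.≤-reflexive (trans (cong (ℕ._∸ (suc N + 2) / 2) k≡) (complementSize N))

  N<q : suc N ≤ q
  N<q = ℕP.≤-trans (ℕP.≤-trans (ℕP.m≤m+n (suc N) (suc N / 2)) (ℕP.≤-reflexive (sym k≡))) k≤q
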